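{- For every integer $n\geq 1$, the chain triangular cactus $T_n$ of length $n$ satisfies $\pi(T_n)=2^{n}+n$.
   Context: Let $G=(V,E)$ be a simple connected graph. A configuration is a function $f:V\to\mathbb{N}\cup\{0\}$, with weight $|f|=\sum_{u\in V}f(u)$. A pebbling step from a vertex $u$ to a neighbor $v$ decreases $f(u)$ by two and increases $f(v)$ by one. A configuration is solvable if for every vertex $v$ there is a (possibly empty) sequence of pebbling steps resulting in at least one pebble on $v$. The pebbling number $\pi(G)$ is the minimum $k$ such that every configuration of weight $k$ is solvable. A cactus is a connected graph in which every block (maximal subgraph without a cut-vertex) is an edge or a cycle. A triangular cactus is a cactus all of whose blocks are triangles. A chain triangular cactus is a triangular cactus in which every triangle contains at most two cut-vertices and every cut-vertex is shared by exactly two triangles; its length is the number of triangles. All chain triangular cacti of length $n$ are isomorphic, and $T_n$ denotes this graph. -}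

module Defs where

open import Data.Nat using (ℕ; zero; suc; _+_; _≤_)
open import Data.Fin using (Fin; toℕ)
open import Data.List using (List; map; _++_; allFin)
open import Data.Nat.ListAction using (sum)
open import Data.Product using (Σ; ∃; _×_; _,_)
open import Data.Sum using (_⊎_)
open import Relation.Binary.PropositionalEquality using (_≡_; _≢_)
open import Relation.Binary.Construct.Closure.ReflexiveTransitive using (Star)

-- A (finite, simple) graph given by a vertex type, an adjacency relation
-- and an enumeration of its vertices (each vertex listed exactly once).

record Graph : Set₁ where
  field
    Vertex   : Set
    Adj      : Vertex → Vertex → Set
    vertices : List Vertex

module Pebbling (G : Graph) where
  open Graph G

  Config : Set
  Config = Vertex → ℕ

  weight : Config → ℕ
  weight f = sum (map f vertices)

  Step : Config → Config → Set
  Step f g = Σ Vertex λ u → Σ Vertex λ v →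
    Adj u v × 2 ≤ f u × g u + 2 ≡ f u × g v ≡ suc (f v) ×
    (∀ w → w ≢ u → w ≢ v → g w ≡ f w)

  Reaches : Config → Config → Set
  Reaches = Star Step

  Solvable : Config → Set
  Solvable f = ∀ (t : Vertex) → ∃ λ g → Reaches f g × 1 ≤ g t

  PebblingProperty : ℕ → Set
  PebblingProperty k = ∀ (f : Config) → weight f ≡ k → Solvable f

  PebblingNumber≡ : ℕ → Set
  PebblingNumber≡ p = PebblingProperty p × (∀ k → PebblingProperty k → p ≤ k)

-- Vertices: spine vertices s_0 … s_n and apex vertices t_0 … t_{n-1};
-- the k-th triangle (0 ≤ k < n) is {s_k, s_{k+1}, t_k}.

data TVertex (n : ℕ) : Set where
  spine : Fin (suc n) → TVertex n
  apex  : Fin n → TVertex n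

data TEdge (n : ℕ) : TVertex n → TVertex n → Set where
  s-s : ∀ {i j : Fin (suc n)} → suc (toℕ i) ≡ toℕ j → TEdge n (spine i) (spine j)
  s-a : ∀ {i : Fin (suc n)} {k : Fin n} → toℕ i ≡ toℕ k → TEdge n (spine i) (apex k)
  s'-a : ∀ {i : Fin (suc n)} {k : Fin n} → toℕ i ≡ suc (toℕ k) → TEdge n (spine i) (apex k)

TAdj : (n : ℕ) → TVertex n → TVertex n → Set
TAdj n u v = TEdge n u v ⊎ TEdge n v u

T : ℕ → Graph
T n = record
  { Vertex   = TVertex n
  ; Adj      = TAdj n
  ; vertices = map spine (allFin (suc n)) ++ map apex (allFin n)
  }

{-# OPTIONS --safe #-}
module Submission where

-- Write s₀ … sₙ for the spine and t₀ … tₙ₋₁ for the apexes, triangle j being {sⱼ, sⱼ₊₁, tⱼ}.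
-- Seen from a spine vertex sᵢ, the triangles on either side form a comb: a path rooted at sᵢ
-- with a pendant apex at each edge. Pushing pebbles greedily towards the root, halving at every
-- edge, delivers `gather` pebbles there, and a comb of length d that delivers at most q pebbles
-- carries fewer than 2ᵈ(q + 1) + d.
-- Upper bound: if neither comb at sᵢ delivers a pebble, the weight is at most
-- (2ⁱ + i − 1) + (2ⁿ⁻ⁱ + n − i − 1) ≤ 2ⁿ + n − 1. An empty apex tₖ is reached unless both the
-- comb at sₖ and the one at sₖ₊₁ deliver at most one pebble, which bounds the weight in the
-- same way.
-- Lower bound: the greedy value of the whole chain towards s₀ bounds the number of pebbles on
-- s₀ and never increases, because a pebbling step stays inside one triangle and cannot beat
-- the greedy moves there. Putting p < 2ⁿ pebbles on tₙ₋₁, at most one on sₙ and one on each of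
-- t₀ … tᵣ₋₁ (r < n) gives greedy value 0, and these configurations take every weight below
-- 2ⁿ + n.

open import Defs
open import Data.Nat
open import Data.Nat.Properties
open import Data.Nat.Tactic.RingSolver using (solve-∀)
open import Data.Nat.DivMod using (_mod_; m<n⇒m%n≡m)
open import Data.Nat.ListAction using (sum)
open import Data.Nat.ListAction.Properties using (sum-++)
open import Data.Bool using (true; false; if_then_else_)
open import Data.Fin as Fin using (Fin; toℕ)
open import Data.Fin.Properties using (toℕ<n; toℕ-injective; toℕ-fromℕ<)
open import Data.List using (map; _++_; allFin; tabulate)
open import Data.List.Properties using (map-++; map-tabulate)
open import Data.Product using (∃; _×_; _,_; proj₁; proj₂)
open import Data.Sum using (_⊎_; inj₁; inj₂; swap)
open import Relation.Nullary using (Dec; yes; no; contradiction)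
import Relation.Nullary.Decidable as Dec
open import Relation.Binary.Definitions using (DecidableEquality)
open import Relation.Binary.PropositionalEquality
open import Relation.Binary.Construct.Closure.ReflexiveTransitive using (ε; _◅_; _◅◅_)
open import Function using (_∘_)

⌊1+n/2⌋≤1+⌊n/2⌋ : ∀ n → ⌊ suc n /2⌋ ≤ suc ⌊ n /2⌋
⌊1+n/2⌋≤1+⌊n/2⌋ zero          = z≤n
⌊1+n/2⌋≤1+⌊n/2⌋ (suc zero)    = s≤s z≤n
⌊1+n/2⌋≤1+⌊n/2⌋ (suc (suc n)) = s≤s (⌊1+n/2⌋≤1+⌊n/2⌋ n)

2*⌊n/2⌋≤n : ∀ n → 2 * ⌊ n /2⌋ ≤ n
2*⌊n/2⌋≤n n = begin
  2 * ⌊ n /2⌋          ≡⟨ cong (⌊ n /2⌋ +_) (+-identityʳ ⌊ n /2⌋) ⟩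
  ⌊ n /2⌋ + ⌊ n /2⌋    ≤⟨ +-monoʳ-≤ ⌊ n /2⌋ (⌊n/2⌋≤⌈n/2⌉ n) ⟩
  ⌊ n /2⌋ + ⌈ n /2⌉    ≡⟨ ⌊n/2⌋+⌈n/2⌉≡n n ⟩
  n                    ∎
  where open ≤-Reasoning

n≤1+2*⌊n/2⌋ : ∀ n → n ≤ suc (2 * ⌊ n /2⌋)
n≤1+2*⌊n/2⌋ n = begin
  n                        ≡⟨ ⌊n/2⌋+⌈n/2⌉≡n n ⟨
  ⌊ n /2⌋ + ⌈ n /2⌉        ≤⟨ +-monoʳ-≤ ⌊ n /2⌋ (⌊1+n/2⌋≤1+⌊n/2⌋ n) ⟩
  ⌊ n /2⌋ + suc ⌊ n /2⌋    ≡⟨ +-suc ⌊ n /2⌋ ⌊ n /2⌋ ⟩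
  suc (⌊ n /2⌋ + ⌊ n /2⌋)  ≡⟨ cong (λ t → suc (⌊ n /2⌋ + t)) (+-identityʳ ⌊ n /2⌋) ⟨
  suc (2 * ⌊ n /2⌋)        ∎
  where open ≤-Reasoning

m<2*n⇒⌊m/2⌋<n : ∀ {m n} → m < 2 * n → ⌊ m /2⌋ < n
m<2*n⇒⌊m/2⌋<n {m} {n} m<2n = *-cancelˡ-< 2 ⌊ m /2⌋ n (≤-<-trans (2*⌊n/2⌋≤n m) m<2n)

n≤1⇒⌊n/2⌋≡0 : ∀ {n} → n ≤ 1 → ⌊ n /2⌋ ≡ 0
n≤1⇒⌊n/2⌋≡0 z≤n       = refl
n≤1⇒⌊n/2⌋≡0 (s≤s z≤n) = refl

2*[1+k]≤x+2⇒2*k≤x : ∀ k {x} → 2 * suc k ≤ x + 2 → 2 * k ≤ x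
2*[1+k]≤x+2⇒2*k≤x k {x} le =
  +-cancelʳ-≤ 2 (2 * k) x (subst (_≤ x + 2) (trans (*-suc 2 k) (+-comm 2 (2 * k))) le)

2^m+2^n≤2^[m+n]+1 : ∀ m n → 2 ^ m + 2 ^ n ≤ 2 ^ (m + n) + 1
2^m+2^n≤2^[m+n]+1 m n
  with 2 ^ m | 2 ^ n | m^n>0 2 m | m^n>0 2 n | ^-distribˡ-+-* 2 m n
... | suc x | suc y | _ | _ | 2^[m+n]≡ = begin
  suc x + suc y               ≤⟨ m≤m+n (suc x + suc y) (x * y) ⟩
  suc x + suc y + x * y       ≡⟨ expand x y ⟩
  suc x * suc y + 1           ≡⟨ cong (_+ 1) 2^[m+n]≡ ⟨
  2 ^ (m + n) + 1             ∎
  where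
  open ≤-Reasoning
  expand : ∀ x y → suc x + suc y + x * y ≡ suc x * suc y + 1
  expand = solve-∀

sum<2^[i+d]+[i+d] : ∀ {wl wr} i d → wl < 2 ^ i * 1 + i → wr < 2 ^ d * 1 + d → wl + wr < 2 ^ (i + d) + (i + d)
sum<2^[i+d]+[i+d] {wl} {wr} i d wl< wr< = s≤s⁻¹ (begin
  suc (suc (wl + wr))               ≡⟨ cong suc (+-suc wl wr) ⟨
  suc wl + suc wr                   ≤⟨ +-mono-≤ wl< wr< ⟩
  (2 ^ i * 1 + i) + (2 ^ d * 1 + d) ≡⟨ regroup (2 ^ i) (2 ^ d) i d ⟩
  (2 ^ i + 2 ^ d) + (i + d)         ≤⟨ +-monoˡ-≤ (i + d) (2^m+2^n≤2^[m+n]+1 i d) ⟩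
  (2 ^ (i + d) + 1) + (i + d)       ≡⟨ cong (_+ (i + d)) (+-comm (2 ^ (i + d)) 1) ⟩
  suc (2 ^ (i + d) + (i + d))       ∎)
  where
  open ≤-Reasoning
  regroup : ∀ A B i d → (A * 1 + i) + (B * 1 + d) ≡ (A + B) + (i + d)
  regroup = solve-∀

sum<2^[1+k+d]+[1+k+d] : ∀ {wl wr} k d → wl < 2 ^ k * 2 + k → wr < 2 ^ d * 2 + d →
                        wl + wr < 2 ^ suc (k + d) + suc (k + d)
sum<2^[1+k+d]+[1+k+d] {wl} {wr} k d wl< wr< = s≤s⁻¹ (begin
  suc (suc (wl + wr))               ≡⟨ cong suc (+-suc wl wr) ⟨
  suc wl + suc wr                   ≤⟨ +-mono-≤ wl< wr< ⟩
  (2 ^ k * 2 + k) + (2 ^ d * 2 + d) ≡⟨ regroup (2 ^ k) (2 ^ d) k d ⟩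
  2 * (2 ^ k + 2 ^ d) + (k + d)     ≤⟨ +-monoˡ-≤ (k + d) (*-monoʳ-≤ 2 (2^m+2^n≤2^[m+n]+1 k d)) ⟩
  2 * (2 ^ (k + d) + 1) + (k + d)   ≡⟨ regroup′ (2 ^ (k + d)) (k + d) ⟩
  suc (2 * 2 ^ (k + d) + suc (k + d)) ∎)
  where
  open ≤-Reasoning
  regroup : ∀ A B k d → (A * 2 + k) + (B * 2 + d) ≡ 2 * (A + B) + (k + d)
  regroup = solve-∀
  regroup′ : ∀ A s → 2 * (A + 1) + s ≡ suc (2 * A + suc s)
  regroup′ = solve-∀

≡ᵇ-refl : ∀ i → (i ≡ᵇ i) ≡ true
≡ᵇ-refl zero    = refl
≡ᵇ-refl (suc i) = ≡ᵇ-refl i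

<⇒≡ᵇ-false : ∀ {i j} → i < j → (i ≡ᵇ j) ≡ false
<⇒≡ᵇ-false {zero}  z<s       = refl
<⇒≡ᵇ-false {suc i} (s<s i<j) = <⇒≡ᵇ-false i<j

≤⇒<ᵇ-false : ∀ {i j} → j ≤ i → (i <ᵇ j) ≡ false
≤⇒<ᵇ-false z≤n       = refl
≤⇒<ᵇ-false (s≤s j≤i) = ≤⇒<ᵇ-false j≤i

if-then-0≤ : ∀ b x → (if b then x else 0) ≤ x
if-then-0≤ true  x = ≤-refl
if-then-0≤ false x = z≤n

sumBelow : ℕ → (ℕ → ℕ) → ℕ
sumBelow zero    h = 0
sumBelow (suc k) h = h 0 + sumBelow k (h ∘ suc)

sumBelow-+ : ∀ i d h → sumBelow (i + d) h ≡ sumBelow i h + sumBelow d (h ∘ (i +_))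
sumBelow-+ zero    d h = refl
sumBelow-+ (suc i) d h =
  trans (cong (h 0 +_) (sumBelow-+ i d (h ∘ suc))) (sym (+-assoc (h 0) _ _))

sumBelow-suc : ∀ k h → sumBelow (suc k) h ≡ sumBelow k h + h k
sumBelow-suc zero    h = +-comm (h 0) 0
sumBelow-suc (suc k) h =
  trans (cong (h 0 +_) (sumBelow-suc k (h ∘ suc))) (sym (+-assoc (h 0) _ _))

sumBelow-reverse : ∀ k h → sumBelow k (λ i → h (k ∸ suc i)) ≡ sumBelow k h
sumBelow-reverse zero    h = refl
sumBelow-reverse (suc k) h = begin
  h k + sumBelow k (λ i → h (k ∸ suc i))   ≡⟨ cong (h k +_) (sumBelow-reverse k h) ⟩
  h k + sumBelow k h                       ≡⟨ +-comm (h k) _ ⟩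
  sumBelow k h + h k                       ≡⟨ sumBelow-suc k h ⟨
  sumBelow (suc k) h                       ∎
  where open ≡-Reasoning

sumBelow-zeros : ∀ k → sumBelow k (λ _ → 0) ≡ 0
sumBelow-zeros zero    = refl
sumBelow-zeros (suc k) = sumBelow-zeros k

sumBelow-distrib : ∀ k g h → sumBelow k (λ i → g i + h i) ≡ sumBelow k g + sumBelow k h
sumBelow-distrib zero    g h = refl
sumBelow-distrib (suc k) g h = trans (cong (g 0 + h 0 +_) (sumBelow-distrib k (g ∘ suc) (h ∘ suc)))
                                     (shuffle (g 0) (h 0) _ _)
  where
  shuffle : ∀ a b c d → a + b + (c + d) ≡ a + c + (b + d)
  shuffle = solve-∀

sumBelow-point : ∀ k j p → j < k → sumBelow k (λ i → if i ≡ᵇ j then p else 0) ≡ p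
sumBelow-point (suc k) zero    p _         = trans (cong (p +_) (sumBelow-zeros k)) (+-identityʳ p)
sumBelow-point (suc k) (suc j) p (s<s j<k) = sumBelow-point k j p j<k

sumBelow-prefix : ∀ k r → r ≤ k → sumBelow k (λ i → if i <ᵇ r then 1 else 0) ≡ r
sumBelow-prefix k       zero    _         = sumBelow-zeros k
sumBelow-prefix (suc k) (suc r) (s≤s r≤k) = cong suc (sumBelow-prefix k r r≤k)

sum-tabulate : ∀ {k} (h : Fin k → ℕ) {h′ : ℕ → ℕ} → (∀ x → h x ≡ h′ (toℕ x)) → sum (tabulate h) ≡ sumBelow k h′
sum-tabulate {zero}  h h≡ = refl
sum-tabulate {suc k} h h≡ = cong₂ _+_ (h≡ Fin.zero) (sum-tabulate (h ∘ Fin.suc) (h≡ ∘ Fin.suc))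

combWeight : ℕ → (ℕ → ℕ) → (ℕ → ℕ) → ℕ
combWeight d a b = sumBelow (suc d) a + sumBelow d b

combWeight-reverse : ∀ i a b → combWeight i (λ j → a (i ∸ j)) (λ j → b (i ∸ suc j)) ≡ combWeight i a b
combWeight-reverse i a b = cong₂ _+_ (sumBelow-reverse (suc i) a) (sumBelow-reverse i b)

combWeight-split : ∀ i d a b →
  combWeight (i + d) a b ≤ combWeight i a b + combWeight d (a ∘ (i +_)) (b ∘ (i +_))
combWeight-split i d a b = begin
  sumBelow (suc (i + d)) a + sumBelow (i + d) b
    ≡⟨ cong₂ _+_ (trans (cong (λ t → sumBelow t a) (sym (+-suc i d))) (sumBelow-+ i (suc d) a))
                 (sumBelow-+ i d b) ⟩
  (sumBelow i a + a′) + (sumBelow i b + b′)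
    ≤⟨ +-monoˡ-≤ _ (+-monoˡ-≤ a′ (m≤m+n (sumBelow i a) (a i))) ⟩
  ((sumBelow i a + a i) + a′) + (sumBelow i b + b′)
    ≡⟨ cong (λ t → (t + a′) + (sumBelow i b + b′)) (sumBelow-suc i a) ⟨
  (sumBelow (suc i) a + a′) + (sumBelow i b + b′)
    ≡⟨ shuffle (sumBelow (suc i) a) a′ (sumBelow i b) b′ ⟩
  (sumBelow (suc i) a + sumBelow i b) + (a′ + b′)
    ∎
  where
  open ≤-Reasoning
  a′ = sumBelow (suc d) (a ∘ (i +_))
  b′ = sumBelow d (b ∘ (i +_))
  shuffle : ∀ w x y z → (w + x) + (y + z) ≡ (w + y) + (x + z)
  shuffle = solve-∀

combWeight-split-apex : ∀ k d a b →
  combWeight (suc (k + d)) a b ≡ combWeight k a b + b k + combWeight d (a ∘ (suc k +_)) (b ∘ (suc k +_))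
combWeight-split-apex k d a b = begin
  sumBelow (suc (suc (k + d))) a + sumBelow (suc (k + d)) b
    ≡⟨ cong₂ _+_ (trans (cong (λ t → sumBelow (suc t) a) (sym (+-suc k d))) (sumBelow-+ (suc k) (suc d) a))
                 (sumBelow-+ (suc k) d b) ⟩
  (sumBelow (suc k) a + a′) + (sumBelow (suc k) b + b′)
    ≡⟨ cong (λ t → (sumBelow (suc k) a + a′) + (t + b′)) (sumBelow-suc k b) ⟩
  (sumBelow (suc k) a + a′) + ((sumBelow k b + b k) + b′)
    ≡⟨ shuffle (sumBelow (suc k) a) a′ (sumBelow k b) (b k) b′ ⟩
  (sumBelow (suc k) a + sumBelow k b) + b k + (a′ + b′)
    ∎
  where
  open ≡-Reasoning
  a′ = sumBelow (suc d) (a ∘ (suc k +_))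
  b′ = sumBelow d (b ∘ (suc k +_))
  shuffle : ∀ v w x y z → (v + w) + ((x + y) + z) ≡ (v + x) + y + (w + z)
  shuffle = solve-∀

-- A comb of length d has back vertices r₀ … r_d and teeth e₀ … e_(d-1), eᵢ adjacent to rᵢ,
-- carrying a i and b i pebbles. gather d a b is what reaches r₀ when, from the far end
-- inwards, every vertex sends half of what it holds one step towards r₀.
inflow : ℕ → (ℕ → ℕ) → (ℕ → ℕ) → ℕ
inflow zero    a b = 0
inflow (suc d) a b = ⌊ a 1 + inflow d (a ∘ suc) (b ∘ suc) /2⌋ + ⌊ b 0 /2⌋

gather : ℕ → (ℕ → ℕ) → (ℕ → ℕ) → ℕ
gather d a b = a 0 + inflow d a b

inflow-cong : ∀ d {a a′ b b′} → (∀ i → i < d → a′ (suc i) ≡ a (suc i)) → (∀ i → i < d → b′ i ≡ b i) →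
              inflow d a′ b′ ≡ inflow d a b
inflow-cong zero    a≡ b≡ = refl
inflow-cong (suc d) a≡ b≡ = cong₂ (λ x y → ⌊ x /2⌋ + ⌊ y /2⌋)
  (cong₂ _+_ (a≡ 0 z<s) (inflow-cong d (λ i i<d → a≡ (suc i) (s<s i<d)) (λ i i<d → b≡ (suc i) (s<s i<d))))
  (b≡ 0 z<s)

Triple : Set
Triple = ℕ × ℕ × ℕ

-- gather d a b depends on (a m , a (m + 1) , b m) only through localGather X, where X is the
-- inflow into position m + 1.
localGather : ℕ → Triple → ℕ
localGather X (x , y , z) = x + (⌊ y + X /2⌋ + ⌊ z /2⌋)

_≼_ : Triple → Triple → Set
t′ ≼ t = ∀ X → localGather X t′ ≤ localGather X t

gather-local : ∀ d m {a b a′ b′} → m < d →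
  (∀ i → i ≤ d → i ≢ m → i ≢ suc m → a′ i ≡ a i) →
  (∀ i → i < d → i ≢ m → b′ i ≡ b i) →
  (a′ m , a′ (suc m) , b′ m) ≼ (a m , a (suc m) , b m) →
  gather d a′ b′ ≤ gather d a b
gather-local (suc d) zero {a} {b} {a′} {b′} _ a≡ b≡ local =
  subst (λ X → localGather X (a′ 0 , a′ 1 , b′ 0) ≤ gather (suc d) a b) (sym inflow≡) (local _)
  where
  inflow≡ : inflow d (a′ ∘ suc) (b′ ∘ suc) ≡ inflow d (a ∘ suc) (b ∘ suc)
  inflow≡ = inflow-cong d (λ i i<d → a≡ (suc (suc i)) (s≤s i<d) (λ ()) (λ ()))
                          (λ i i<d → b≡ (suc i) (s≤s i<d) (λ ()))
gather-local (suc d) (suc m) {a} {b} {a′} {b′} (s<s m<d) a≡ b≡ local =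
  subst₂ (λ x y → x + (⌊ gather d (a′ ∘ suc) (b′ ∘ suc) /2⌋ + ⌊ y /2⌋) ≤ gather (suc d) a b)
    (sym (a≡ 0 z≤n (λ ()) (λ ()))) (sym (b≡ 0 z<s (λ ())))
    (+-monoʳ-≤ (a 0) (+-monoˡ-≤ ⌊ b 0 /2⌋ (⌊n/2⌋-mono tail≤)))
  where
  tail≤ : gather d (a′ ∘ suc) (b′ ∘ suc) ≤ gather d (a ∘ suc) (b ∘ suc)
  tail≤ = gather-local d m m<d
    (λ i i≤d i≢m i≢1+m → a≡ (suc i) (s≤s i≤d) (i≢m ∘ suc-injective) (i≢1+m ∘ suc-injective))
    (λ i i<d i≢m → b≡ (suc i) (s<s i<d) (i≢m ∘ suc-injective))
    local

left→right : ∀ {x y z x′ y′ z′} → 2 + x′ ≡ x → y′ ≡ suc y → z′ ≡ z → (x′ , y′ , z′) ≼ (x , y , z)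
left→right {y = y} {z} {x′} refl refl refl X = begin
  x′ + (⌊ suc y + X /2⌋ + ⌊ z /2⌋)   ≤⟨ +-monoʳ-≤ x′ (+-monoˡ-≤ ⌊ z /2⌋ (⌊1+n/2⌋≤1+⌊n/2⌋ (y + X))) ⟩
  x′ + suc (⌊ y + X /2⌋ + ⌊ z /2⌋)   ≡⟨ +-suc x′ _ ⟩
  suc (x′ + (⌊ y + X /2⌋ + ⌊ z /2⌋)) ≤⟨ n≤1+n _ ⟩
  2 + x′ + (⌊ y + X /2⌋ + ⌊ z /2⌋)   ∎
  where open ≤-Reasoning

right→left : ∀ {x y z x′ y′ z′} → x′ ≡ suc x → 2 + y′ ≡ y → z′ ≡ z → (x′ , y′ , z′) ≼ (x , y , z)
right→left {x} refl refl refl X = ≤-reflexive (sym (+-suc x _))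

left→apex : ∀ {x y z x′ y′ z′} → 2 + x′ ≡ x → y′ ≡ y → z′ ≡ suc z → (x′ , y′ , z′) ≼ (x , y , z)
left→apex {y = y} {z} {x′} refl refl refl X = begin
  x′ + (⌊ y + X /2⌋ + ⌊ suc z /2⌋)   ≤⟨ +-monoʳ-≤ x′ (+-monoʳ-≤ ⌊ y + X /2⌋ (⌊1+n/2⌋≤1+⌊n/2⌋ z)) ⟩
  x′ + (⌊ y + X /2⌋ + suc ⌊ z /2⌋)   ≡⟨ cong (x′ +_) (+-suc _ _) ⟩
  x′ + suc (⌊ y + X /2⌋ + ⌊ z /2⌋)   ≡⟨ +-suc x′ _ ⟩
  suc (x′ + (⌊ y + X /2⌋ + ⌊ z /2⌋)) ≤⟨ n≤1+n _ ⟩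
  2 + x′ + (⌊ y + X /2⌋ + ⌊ z /2⌋)   ∎
  where open ≤-Reasoning

apex→left : ∀ {x y z x′ y′ z′} → x′ ≡ suc x → y′ ≡ y → 2 + z′ ≡ z → (x′ , y′ , z′) ≼ (x , y , z)
apex→left {x} {y} {z′ = z′} refl refl refl X =
  ≤-reflexive (sym (trans (cong (x +_) (+-suc ⌊ y + X /2⌋ ⌊ z′ /2⌋)) (+-suc x _)))

right→apex : ∀ {x y z x′ y′ z′} → x′ ≡ x → 2 + y′ ≡ y → z′ ≡ suc z → (x′ , y′ , z′) ≼ (x , y , z)
right→apex {x} {z = z} {y′ = y′} refl refl refl X =
  +-monoʳ-≤ x (≤-trans (+-monoʳ-≤ ⌊ y′ + X /2⌋ (⌊1+n/2⌋≤1+⌊n/2⌋ z)) (≤-reflexive (+-suc _ _)))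

apex→right : ∀ {x y z x′ y′ z′} → x′ ≡ x → y′ ≡ suc y → 2 + z′ ≡ z → (x′ , y′ , z′) ≼ (x , y , z)
apex→right {x} {y} {z′ = z′} refl refl refl X =
  +-monoʳ-≤ x (≤-trans (+-monoˡ-≤ ⌊ z′ /2⌋ (⌊1+n/2⌋≤1+⌊n/2⌋ (y + X))) (≤-reflexive (sym (+-suc _ _))))

combWeight<2^d*[1+gather]+d : ∀ d a b → combWeight d a b < 2 ^ d * suc (gather d a b) + d
combWeight<2^d*[1+gather]+d zero a b = ≤-reflexive (cong suc (sym (+-identityʳ _)))
combWeight<2^d*[1+gather]+d (suc d) a b = begin-strict
  (x + A) + (y + B)
    ≡⟨ shuffle x A y B ⟩
  x + y + (A + B)
    <⟨ +-monoʳ-< (x + y) (combWeight<2^d*[1+gather]+d d (a ∘ suc) (b ∘ suc)) ⟩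
  x + y + (P * suc Q + d)
    ≤⟨ +-mono-≤ (+-monoʳ-≤ x (n≤1+2*⌊n/2⌋ y)) (+-monoˡ-≤ d (*-monoʳ-≤ P (s≤s (n≤1+2*⌊n/2⌋ Q)))) ⟩
  x + suc (2 * β) + (P * suc (suc (2 * h)) + d)
    ≤⟨ +-monoˡ-≤ _ (+-mono-≤ (m≤n*m x (2 * P) {{m^n≢0 2 (suc d)}})
                             (s≤s (*-monoʳ-≤ 2 (m≤n*m β P {{m^n≢0 2 d}})))) ⟩
  2 * P * x + suc (2 * (P * β)) + (P * suc (suc (2 * h)) + d)
    ≡⟨ collect P x β h d ⟩
  2 * P * suc (x + (h + β)) + suc d
    ∎
  where
  open ≤-Reasoning
  x = a 0
  y = b 0
  A = sumBelow (suc d) (a ∘ suc)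
  B = sumBelow d (b ∘ suc)
  Q = gather d (a ∘ suc) (b ∘ suc)
  h = ⌊ Q /2⌋
  β = ⌊ y /2⌋
  P = 2 ^ d
  shuffle : ∀ x A y B → (x + A) + (y + B) ≡ x + y + (A + B)
  shuffle = solve-∀
  collect : ∀ P x β h d →
            2 * P * x + suc (2 * (P * β)) + (P * suc (suc (2 * h)) + d) ≡ 2 * P * suc (x + (h + β)) + suc d
  collect = solve-∀

gather≤⇒combWeight< : ∀ d {q} a b → gather d a b ≤ q → combWeight d a b < 2 ^ d * suc q + d
gather≤⇒combWeight< d a b g≤q =
  <-≤-trans (combWeight<2^d*[1+gather]+d d a b) (+-monoˡ-≤ d (*-monoʳ-≤ (2 ^ d) (s≤s g≤q)))

gather<2^c : ∀ e c {a b} → (∀ i → i ≤ e → a i ≡ 0) → a (suc e) ≤ 1 → (∀ i → i < e → b i ≤ 1) →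
             b e < 2 ^ (c + suc e) → gather (suc e) a b < 2 ^ c
gather<2^c zero c {a} {b} a≡0 a₁≤1 _ bₑ< rewrite a≡0 0 z≤n | +-identityʳ (a 1) | n≤1⇒⌊n/2⌋≡0 a₁≤1 =
  m<2*n⇒⌊m/2⌋<n (subst (λ t → b 0 < 2 ^ t) (+-comm c 1) bₑ<)
gather<2^c (suc e) c {a} {b} a≡0 aₑ≤1 b≤1 bₑ<
  rewrite a≡0 0 z≤n | n≤1⇒⌊n/2⌋≡0 (b≤1 0 z<s) | +-identityʳ ⌊ gather (suc e) (a ∘ suc) (b ∘ suc) /2⌋ =
  m<2*n⇒⌊m/2⌋<n (gather<2^c e (suc c) (λ i i≤e → a≡0 (suc i) (s≤s i≤e)) aₑ≤1 (λ i i<e → b≤1 (suc i) (s<s i<e))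
                  (subst (λ t → b (suc e) < 2 ^ t) (+-suc c (suc e)) bₑ<))

module Greedy (G : Graph) (_≟_ : DecidableEquality (Graph.Vertex G))
              (Adj⇒≢ : ∀ {u v} → Graph.Adj G u v → u ≢ v) where
  open Graph G
  open Pebbling G

  private
    afterMove : Vertex → Vertex → Config → Config
    afterMove u v f w with w ≟ u | w ≟ v
    ... | yes _ | _     = f u ∸ 2
    ... | no _  | yes _ = suc (f v)
    ... | no _  | no _  = f w

    afterMove-source : ∀ u v f → afterMove u v f u ≡ f u ∸ 2
    afterMove-source u v f with u ≟ u
    ... | yes _   = refl
    ... | no u≢u = contradiction refl u≢u

    afterMove-target : ∀ {u v} f → u ≢ v → afterMove u v f v ≡ suc (f v)
    afterMove-target {u} {v} f u≢v with v ≟ u | v ≟ v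
    ... | yes v≡u | _       = contradiction (sym v≡u) u≢v
    ... | no _    | yes _   = refl
    ... | no _    | no v≢v = contradiction refl v≢v

    afterMove-other : ∀ {u v w} f → w ≢ u → w ≢ v → afterMove u v f w ≡ f w
    afterMove-other {u} {v} {w} f w≢u w≢v with w ≟ u | w ≟ v
    ... | yes w≡u | _       = contradiction w≡u w≢u
    ... | no _    | yes w≡v = contradiction w≡v w≢v
    ... | no _    | no _    = refl

  move : ∀ {u v} → Adj u v → ∀ f → 2 ≤ f u →
         ∃ λ g → Step f g × g u + 2 ≡ f u × g v ≡ suc (f v) × (∀ w → w ≢ u → f w ≤ g w)
  move {u} {v} u~v f 2≤fu =
    afterMove u v f , (u , v , u~v , 2≤fu , source , target , λ w → afterMove-other f) , source , target , kept
    where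
    source : afterMove u v f u + 2 ≡ f u
    source = trans (cong (_+ 2) (afterMove-source u v f)) (m∸n+n≡m 2≤fu)
    target : afterMove u v f v ≡ suc (f v)
    target = afterMove-target f (Adj⇒≢ u~v)
    kept : ∀ w → w ≢ u → f w ≤ afterMove u v f w
    kept w w≢u = by-cases (w ≟ v)
      where
      by-cases : Dec (w ≡ v) → f w ≤ afterMove u v f w
      by-cases (yes refl) = ≤-trans (n≤1+n (f v)) (≤-reflexive (sym target))
      by-cases (no w≢v)   = ≤-reflexive (sym (afterMove-other f w≢u w≢v))

  transfer : ∀ {u v} → Adj u v → ∀ k f → 2 * k ≤ f u →
             ∃ λ g → Reaches f g × f v + k ≤ g v × (∀ w → w ≢ u → f w ≤ g w)
  transfer u~v zero f _ = f , ε , ≤-reflexive (+-identityʳ _) , λ _ _ → ≤-refl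
  transfer {u} {v} u~v (suc k) f 2[1+k]≤fu
    with g₁ , s , g₁u+2≡fu , g₁v≡1+fv , kept₁ ← move u~v f (≤-trans (*-monoʳ-≤ 2 (s≤s z≤n)) 2[1+k]≤fu)
    with g , r , gv≥ , kept ← transfer u~v k g₁
                                (2*[1+k]≤x+2⇒2*k≤x k (subst (2 * suc k ≤_) (sym g₁u+2≡fu) 2[1+k]≤fu))
    = g , s ◅ r
    , ≤-trans (≤-reflexive (trans (+-suc (f v) k) (cong (_+ k) (sym g₁v≡1+fv)))) gv≥
    , λ w w≢u → ≤-trans (kept₁ w w≢u) (kept w w≢u)

  record Comb (d : ℕ) : Set where
    field
      back            : ℕ → Vertex
      tooth           : ℕ → Vertex
      back-adj        : ∀ i → i < d → Adj (back (suc i)) (back i)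
      tooth-adj       : ∀ i → i < d → Adj (tooth i) (back i)
      back-injective  : ∀ {i j} → i ≤ d → j ≤ d → back i ≡ back j → i ≡ j
      tooth-injective : ∀ {i j} → i < d → j < d → tooth i ≡ tooth j → i ≡ j
      back≢tooth      : ∀ {i j} → i ≤ d → j < d → back i ≢ tooth j

  open Comb

  tail : ∀ {d} → Comb (suc d) → Comb d
  tail C = record
    { back            = back C ∘ suc
    ; tooth           = tooth C ∘ suc
    ; back-adj        = λ i i<d → back-adj C (suc i) (s<s i<d)
    ; tooth-adj       = λ i i<d → tooth-adj C (suc i) (s<s i<d)
    ; back-injective  = λ i≤d j≤d eq → suc-injective (back-injective C (s≤s i≤d) (s≤s j≤d) eq)
    ; tooth-injective = λ i<d j<d eq → suc-injective (tooth-injective C (s<s i<d) (s<s j<d) eq)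
    ; back≢tooth      = λ i≤d j<d → back≢tooth C (s≤s i≤d) (s<s j<d)
    }

  gatherAt : ∀ {d} → Comb d → Config → ℕ
  gatherAt {d} C f = gather d (f ∘ back C) (f ∘ tooth C)

  combWeightAt : ∀ {d} → Comb d → Config → ℕ
  combWeightAt {d} C f = combWeight d (f ∘ back C) (f ∘ tooth C)

  OffComb : ∀ {d} → Comb d → Vertex → Set
  OffComb {d} C w = ∀ i → i < d → w ≢ back C (suc i) × w ≢ tooth C i

  gather-reachable : ∀ {d} (C : Comb d) f →
    ∃ λ g → Reaches f g × gatherAt C f ≤ g (back C 0) × (∀ w → OffComb C w → f w ≤ g w)
  gather-reachable {zero} C f = f , ε , ≤-reflexive (+-identityʳ _) , λ _ _ → ≤-refl
  gather-reachable {suc d} C f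
    with g₁ , r₁ , tail≤ , kept₁ ← gather-reachable (tail C) f
    with g₂ , r₂ , root₂ , kept₂ ← transfer (back-adj C 0 z<s) ⌊ gatherAt (tail C) f /2⌋ g₁
                                            (≤-trans (2*⌊n/2⌋≤n _) tail≤)
    with g₃ , r₃ , root₃ , kept₃ ← transfer (tooth-adj C 0 z<s) ⌊ g₂ (tooth C 0) /2⌋ g₂ (2*⌊n/2⌋≤n _)
    = g₃ , r₁ ◅◅ r₂ ◅◅ r₃ , root , kept
    where
    root-off-tail : OffComb (tail C) (back C 0)
    root-off-tail i i<d = (λ eq → 0≢1+n (back-injective C z≤n (s≤s i<d) eq))
                        , back≢tooth C z≤n (s<s i<d)
    tooth-off-tail : OffComb (tail C) (tooth C 0)
    tooth-off-tail i i<d = (λ eq → back≢tooth C (s≤s i<d) z<s (sym eq))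
                         , (λ eq → 0≢1+n (tooth-injective C z<s (s<s i<d) eq))
    tooth≤ : f (tooth C 0) ≤ g₂ (tooth C 0)
    tooth≤ = ≤-trans (kept₁ _ tooth-off-tail) (kept₂ _ (λ eq → back≢tooth C (s≤s z≤n) z<s (sym eq)))
    root : gatherAt C f ≤ g₃ (back C 0)
    root = begin
      f (back C 0) + (⌊ gatherAt (tail C) f /2⌋ + ⌊ f (tooth C 0) /2⌋)
        ≤⟨ +-monoˡ-≤ _ (kept₁ _ root-off-tail) ⟩
      g₁ (back C 0) + (⌊ gatherAt (tail C) f /2⌋ + ⌊ f (tooth C 0) /2⌋)
        ≤⟨ +-monoʳ-≤ (g₁ (back C 0)) (+-monoʳ-≤ _ (⌊n/2⌋-mono tooth≤)) ⟩
      g₁ (back C 0) + (⌊ gatherAt (tail C) f /2⌋ + ⌊ g₂ (tooth C 0) /2⌋)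
        ≡⟨ +-assoc (g₁ (back C 0)) _ _ ⟨
      g₁ (back C 0) + ⌊ gatherAt (tail C) f /2⌋ + ⌊ g₂ (tooth C 0) /2⌋
        ≤⟨ +-monoˡ-≤ _ root₂ ⟩
      g₂ (back C 0) + ⌊ g₂ (tooth C 0) /2⌋
        ≤⟨ root₃ ⟩
      g₃ (back C 0) ∎
      where open ≤-Reasoning
    kept : ∀ w → OffComb C w → f w ≤ g₃ w
    kept w off = ≤-trans (kept₁ w (λ i i<d → off (suc i) (s<s i<d)))
                   (≤-trans (kept₂ w (proj₁ (off 0 z<s))) (kept₃ w (proj₂ (off 0 z<s))))

  reach-root : ∀ {d q t} (C : Comb d) f → back C 0 ≡ t → q ≤ gatherAt C f → ∃ λ g → Reaches f g × q ≤ g t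
  reach-root C f refl q≤ with g , r , root , _ ← gather-reachable C f = g , r , ≤-trans q≤ root

  reach-beside-root : ∀ {d t} (C : Comb d) f → Adj (back C 0) t → 2 ≤ gatherAt C f →
                      ∃ λ g → Reaches f g × 1 ≤ g t
  reach-beside-root C f root~t 2≤
    with g , r , 2≤groot ← reach-root C f refl 2≤
    with g′ , s , _ , g′t≡ , _ ← move root~t g 2≤groot
    = g′ , r ◅◅ (s ◅ ε) , ≤-trans (s≤s z≤n) (≤-reflexive (sym g′t≡))

toℕ-mod : ∀ {i k} .{{_ : NonZero k}} → i < k → toℕ (i mod k) ≡ i
toℕ-mod {i} {k} i<k = trans (toℕ-fromℕ< _) (m<n⇒m%n≡m i<k)

mod-toℕ : ∀ {k} .{{_ : NonZero k}} (x : Fin k) → toℕ x mod k ≡ x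
mod-toℕ x = toℕ-injective (toℕ-mod (toℕ<n x))

module Cactus (m : ℕ) where
  n : ℕ
  n = suc m

  open Pebbling (T n)

  spine-injective : ∀ {x y} → spine {n} x ≡ spine y → x ≡ y
  spine-injective refl = refl

  apex-injective : ∀ {x y} → apex {n} x ≡ apex y → x ≡ y
  apex-injective refl = refl

  _≟ᵥ_ : DecidableEquality (TVertex n)
  spine x ≟ᵥ spine y = Dec.map′ (cong spine) spine-injective (x Fin.≟ y)
  spine x ≟ᵥ apex y  = no λ ()
  apex x  ≟ᵥ spine y = no λ ()
  apex x  ≟ᵥ apex y  = Dec.map′ (cong apex) apex-injective (x Fin.≟ y)

  TEdge⇒≢ : ∀ {u v} → TEdge n u v → u ≢ v
  TEdge⇒≢ (s-s 1+i≡i) refl = 1+n≢n 1+i≡i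

  TAdj⇒≢ : ∀ {u v} → TAdj n u v → u ≢ v
  TAdj⇒≢ (inj₁ e) = TEdge⇒≢ e
  TAdj⇒≢ (inj₂ e) = TEdge⇒≢ e ∘ sym

  open Greedy (T n) _≟ᵥ_ TAdj⇒≢

  -- Out-of-range indices wrap around; every use below is bounded.
  spineAt : ℕ → TVertex n
  spineAt i = spine (i mod suc n)

  apexAt : ℕ → TVertex n
  apexAt i = apex (i mod n)

  spineAt-toℕ : ∀ x → spineAt (toℕ x) ≡ spine x
  spineAt-toℕ x = cong spine (mod-toℕ x)

  apexAt-toℕ : ∀ x → apexAt (toℕ x) ≡ apex x
  apexAt-toℕ x = cong apex (mod-toℕ x)

  spineAt-injective : ∀ {i j} → i ≤ n → j ≤ n → spineAt i ≡ spineAt j → i ≡ j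
  spineAt-injective i≤n j≤n eq =
    trans (sym (toℕ-mod (s≤s i≤n))) (trans (cong toℕ (spine-injective eq)) (toℕ-mod (s≤s j≤n)))

  apexAt-injective : ∀ {i j} → i < n → j < n → apexAt i ≡ apexAt j → i ≡ j
  apexAt-injective i<n j<n eq =
    trans (sym (toℕ-mod i<n)) (trans (cong toℕ (apex-injective eq)) (toℕ-mod j<n))

  spineAt-adj : ∀ {i} → i < n → TAdj n (spineAt (suc i)) (spineAt i)
  spineAt-adj i<n = inj₂ (s-s (trans (cong suc (toℕ-mod (m≤n⇒m≤1+n i<n))) (sym (toℕ-mod (s≤s i<n)))))

  apexAt-adj-left : ∀ {i} → i < n → TAdj n (apexAt i) (spineAt i)
  apexAt-adj-left i<n = inj₂ (s-a (trans (toℕ-mod (m≤n⇒m≤1+n i<n)) (sym (toℕ-mod i<n))))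

  apexAt-adj-right : ∀ {i} → i < n → TAdj n (apexAt i) (spineAt (suc i))
  apexAt-adj-right i<n = inj₂ (s'-a (trans (toℕ-mod (s≤s i<n)) (cong suc (sym (toℕ-mod i<n)))))

  rightComb : ∀ i d → i + d ≡ n → Comb d
  rightComb i d i+d≡n = record
    { back            = λ j → spineAt (i + j)
    ; tooth           = λ j → apexAt (i + j)
    ; back-adj        = λ j j<d → subst (λ t → TAdj n (spineAt t) (spineAt (i + j)))
                                          (sym (+-suc i j)) (spineAt-adj (lt j<d))
    ; tooth-adj       = λ j j<d → apexAt-adj-left (lt j<d)
    ; back-injective  = λ j≤d k≤d eq → +-cancelˡ-≡ i _ _ (spineAt-injective (le j≤d) (le k≤d) eq)
    ; tooth-injective = λ j<d k<d eq → +-cancelˡ-≡ i _ _ (apexAt-injective (lt j<d) (lt k<d) eq)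
    ; back≢tooth      = λ _ _ ()
    }
    where
    le : ∀ {j} → j ≤ d → i + j ≤ n
    le {j} j≤d = subst (i + j ≤_) i+d≡n (+-monoʳ-≤ i j≤d)
    lt : ∀ {j} → j < d → i + j < n
    lt {j} j<d = subst (i + j <_) i+d≡n (+-monoʳ-< i j<d)

  leftComb : ∀ i → i ≤ n → Comb i
  leftComb i i≤n = record
    { back            = λ j → spineAt (i ∸ j)
    ; tooth           = λ j → apexAt (i ∸ suc j)
    ; back-adj        = λ j j<i → swap (subst (λ t → TAdj n (spineAt t) (spineAt (i ∸ suc j)))
                                                (sym (i∸j≡ j<i)) (spineAt-adj (lt j<i)))
    ; tooth-adj       = λ j j<i → subst (λ t → TAdj n (apexAt (i ∸ suc j)) (spineAt t))
                                          (sym (i∸j≡ j<i)) (apexAt-adj-right (lt j<i))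
    ; back-injective  = λ {j} {k} j≤i k≤i eq → ∸-cancelˡ-≡ j≤i k≤i (spineAt-injective (le j) (le k) eq)
    ; tooth-injective = λ j<i k<i eq → suc-injective (∸-cancelˡ-≡ j<i k<i (apexAt-injective (lt j<i) (lt k<i) eq))
    ; back≢tooth      = λ _ _ ()
    }
    where
    i∸j≡ : ∀ {j} → j < i → i ∸ j ≡ suc (i ∸ suc j)
    i∸j≡ j<i = +-∸-assoc 1 j<i
    le : ∀ j → i ∸ j ≤ n
    le j = ≤-trans (m∸n≤m i j) i≤n
    lt : ∀ {j} → j < i → i ∸ suc j < n
    lt {j} j<i = subst (_≤ n) (i∸j≡ j<i) (le j)

  weight-by-index : ∀ f (a b : ℕ → ℕ) → (∀ x → f (spine x) ≡ a (toℕ x)) → (∀ x → f (apex x) ≡ b (toℕ x)) →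
                    weight f ≡ combWeight n a b
  weight-by-index f a b fa fb = begin
    sum (map f (map spine (allFin (suc n)) ++ map apex (allFin n)))
      ≡⟨ cong sum (map-++ f (map spine (allFin (suc n))) (map apex (allFin n))) ⟩
    sum (map f (map spine (allFin (suc n))) ++ map f (map apex (allFin n)))
      ≡⟨ sum-++ (map f (map spine (allFin (suc n)))) (map f (map apex (allFin n))) ⟩
    sum (map f (map spine (allFin (suc n)))) + sum (map f (map apex (allFin n)))
      ≡⟨ cong₂ _+_ (cong sum (map-tabulate₂ spine)) (cong sum (map-tabulate₂ apex)) ⟩
    sum (tabulate (f ∘ spine)) + sum (tabulate (f ∘ apex))
      ≡⟨ cong₂ _+_ (sum-tabulate (f ∘ spine) {a} fa) (sum-tabulate (f ∘ apex) {b} fb) ⟩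
    combWeight n a b ∎
    where
    open ≡-Reasoning
    map-tabulate₂ : ∀ {k} (e : Fin k → TVertex n) → map f (map e (allFin k)) ≡ tabulate (f ∘ e)
    map-tabulate₂ e = trans (cong (map f) (map-tabulate (λ x → x) e)) (map-tabulate e f)

  weight≡combWeight : ∀ f → weight f ≡ combWeight n (f ∘ spineAt) (f ∘ apexAt)
  weight≡combWeight f = weight-by-index f (f ∘ spineAt) (f ∘ apexAt)
                          (λ x → cong f (sym (spineAt-toℕ x))) (λ x → cong f (sym (apexAt-toℕ x)))

  toℕ≤n : (x : Fin (suc n)) → toℕ x ≤ n
  toℕ≤n x = s≤s⁻¹ (toℕ<n x)

  leftOfSpine : (x : Fin (suc n)) → Comb (toℕ x)
  leftOfSpine x = leftComb (toℕ x) (toℕ≤n x)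

  rightOfSpine : (x : Fin (suc n)) → Comb (n ∸ toℕ x)
  rightOfSpine x = rightComb (toℕ x) (n ∸ toℕ x) (m+[n∸m]≡n (toℕ≤n x))

  leftOfApex : (x : Fin n) → Comb (toℕ x)
  leftOfApex x = leftComb (toℕ x) (<⇒≤ (toℕ<n x))

  rightOfApex : (x : Fin n) → Comb (m ∸ toℕ x)
  rightOfApex x = rightComb (suc (toℕ x)) (m ∸ toℕ x) (cong suc (m+[n∸m]≡n (s≤s⁻¹ (toℕ<n x))))

  weight≤leftOfSpine+rightOfSpine : ∀ f x →
    weight f ≤ combWeightAt (leftOfSpine x) f + combWeightAt (rightOfSpine x) f
  weight≤leftOfSpine+rightOfSpine f x = begin
    weight f
      ≡⟨ weight≡combWeight f ⟩
    combWeight n a b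
      ≡⟨ cong (λ t → combWeight t a b) (m+[n∸m]≡n (toℕ≤n x)) ⟨
    combWeight (i + (n ∸ i)) a b
      ≤⟨ combWeight-split i (n ∸ i) a b ⟩
    combWeight i a b + combWeightAt (rightOfSpine x) f
      ≡⟨ cong (_+ combWeightAt (rightOfSpine x) f) (combWeight-reverse i a b) ⟨
    combWeightAt (leftOfSpine x) f + combWeightAt (rightOfSpine x) f
      ∎
    where
    open ≤-Reasoning
    i = toℕ x
    a = f ∘ spineAt
    b = f ∘ apexAt

  weight≡leftOfApex+apex+rightOfApex : ∀ f x →
    weight f ≡ combWeightAt (leftOfApex x) f + f (apex x) + combWeightAt (rightOfApex x) f
  weight≡leftOfApex+apex+rightOfApex f x = begin
    weight f
      ≡⟨ weight≡combWeight f ⟩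
    combWeight n a b
      ≡⟨ cong (λ t → combWeight (suc t) a b) (m+[n∸m]≡n (s≤s⁻¹ (toℕ<n x))) ⟨
    combWeight (suc (k + (m ∸ k))) a b
      ≡⟨ combWeight-split-apex k (m ∸ k) a b ⟩
    combWeight k a b + b k + combWeightAt (rightOfApex x) f
      ≡⟨ cong₂ (λ s t → s + t + combWeightAt (rightOfApex x) f) (sym (combWeight-reverse k a b))
                                                                (cong f (apexAt-toℕ x)) ⟩
    combWeightAt (leftOfApex x) f + f (apex x) + combWeightAt (rightOfApex x) f
      ∎
    where
    open ≡-Reasoning
    k = toℕ x
    a = f ∘ spineAt
    b = f ∘ apexAt

  empty-combs-at-spine⇒weight< : ∀ f x → gatherAt (leftOfSpine x) f ≤ 0 → gatherAt (rightOfSpine x) f ≤ 0 →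
                                 weight f < 2 ^ n + n
  empty-combs-at-spine⇒weight< f x left≤0 right≤0 = begin-strict
    weight f
      ≤⟨ weight≤leftOfSpine+rightOfSpine f x ⟩
    combWeightAt (leftOfSpine x) f + combWeightAt (rightOfSpine x) f
      <⟨ sum<2^[i+d]+[i+d] i d (gather≤⇒combWeight< i _ _ left≤0) (gather≤⇒combWeight< d _ _ right≤0) ⟩
    2 ^ (i + d) + (i + d)
      ≡⟨ cong (λ t → 2 ^ t + t) (m+[n∸m]≡n (toℕ≤n x)) ⟩
    2 ^ n + n
      ∎
    where
    open ≤-Reasoning
    i = toℕ x
    d = n ∸ toℕ x

  poor-combs-at-apex⇒weight< : ∀ f x → f (apex x) ≡ 0 →
    gatherAt (leftOfApex x) f ≤ 1 → gatherAt (rightOfApex x) f ≤ 1 → weight f < 2 ^ n + n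
  poor-combs-at-apex⇒weight< f x apex≡0 left≤1 right≤1 = begin-strict
    weight f
      ≡⟨ weight≡leftOfApex+apex+rightOfApex f x ⟩
    wl + f (apex x) + wr
      ≡⟨ cong (λ t → wl + t + wr) apex≡0 ⟩
    wl + 0 + wr
      ≡⟨ cong (_+ wr) (+-identityʳ wl) ⟩
    wl + wr
      <⟨ sum<2^[1+k+d]+[1+k+d] k d (gather≤⇒combWeight< k _ _ left≤1) (gather≤⇒combWeight< d _ _ right≤1) ⟩
    2 ^ suc (k + d) + suc (k + d)
      ≡⟨ cong (λ t → 2 ^ suc t + suc t) (m+[n∸m]≡n (s≤s⁻¹ (toℕ<n x))) ⟩
    2 ^ n + n
      ∎
    where
    open ≤-Reasoning
    k = toℕ x
    d = m ∸ toℕ x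
    wl = combWeightAt (leftOfApex x) f
    wr = combWeightAt (rightOfApex x) f

  solvable-at-spine : ∀ f → weight f ≡ 2 ^ n + n → ∀ x → ∃ λ g → Reaches f g × 1 ≤ g (spine x)
  solvable-at-spine f wf x with 1 ≤? gatherAt (leftOfSpine x) f | 1 ≤? gatherAt (rightOfSpine x) f
  ... | yes 1≤left | _ = reach-root (leftOfSpine x) f (spineAt-toℕ x) 1≤left
  ... | no _ | yes 1≤right =
    reach-root (rightOfSpine x) f (trans (cong spineAt (+-identityʳ (toℕ x))) (spineAt-toℕ x)) 1≤right
  ... | no 1≰left | no 1≰right =
    contradiction wf (<⇒≢ (empty-combs-at-spine⇒weight< f x (≮⇒≥ 1≰left) (≮⇒≥ 1≰right)))

  solvable-at-apex : ∀ f → weight f ≡ 2 ^ n + n → ∀ x → ∃ λ g → Reaches f g × 1 ≤ g (apex x)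
  solvable-at-apex f wf x
    with 1 ≤? f (apex x) | 2 ≤? gatherAt (leftOfApex x) f | 2 ≤? gatherAt (rightOfApex x) f
  ... | yes 1≤apex | _ | _ = f , ε , 1≤apex
  ... | no _ | yes 2≤left | _ = reach-beside-root (leftOfApex x) f left-root~apex 2≤left
    where
    left-root~apex : TAdj n (spineAt (toℕ x)) (apex x)
    left-root~apex = subst (TAdj n _) (apexAt-toℕ x) (swap (apexAt-adj-left (toℕ<n x)))
  ... | no _ | no _ | yes 2≤right = reach-beside-root (rightOfApex x) f right-root~apex 2≤right
    where
    right-root~apex : TAdj n (spineAt (suc (toℕ x) + 0)) (apex x)
    right-root~apex = subst₂ (TAdj n) (cong spineAt (sym (+-identityʳ (suc (toℕ x))))) (apexAt-toℕ x)
                             (swap (apexAt-adj-right (toℕ<n x)))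
  ... | no 1≰apex | no 2≰left | no 2≰right =
    contradiction wf (<⇒≢ (poor-combs-at-apex⇒weight< f x (n<1⇒n≡0 (≰⇒> 1≰apex)) (≮⇒≥ 2≰left) (≮⇒≥ 2≰right)))

  upper-bound : PebblingProperty (2 ^ n + n)
  upper-bound f wf (spine x) = solvable-at-spine f wf x
  upper-bound f wf (apex x)  = solvable-at-apex f wf x

  data TriangleEdge (j : ℕ) : TVertex n → TVertex n → Set where
    left-right : TriangleEdge j (spineAt j) (spineAt (suc j))
    left-apex  : TriangleEdge j (spineAt j) (apexAt j)
    right-apex : TriangleEdge j (spineAt (suc j)) (apexAt j)

  TEdge⇒TriangleEdge : ∀ {u v} → TEdge n u v → ∃ λ j → j < n × TriangleEdge j u v
  TEdge⇒TriangleEdge (s-s {i} {j} 1+i≡j) =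
    toℕ i , subst (_≤ n) (sym 1+i≡j) (toℕ≤n j) ,
    subst₂ (TriangleEdge (toℕ i)) (spineAt-toℕ i) (trans (cong spineAt 1+i≡j) (spineAt-toℕ j)) left-right
  TEdge⇒TriangleEdge (s-a {i} {k} i≡k) =
    toℕ k , toℕ<n k ,
    subst₂ (TriangleEdge (toℕ k)) (trans (cong spineAt (sym i≡k)) (spineAt-toℕ i)) (apexAt-toℕ k) left-apex
  TEdge⇒TriangleEdge (s'-a {i} {k} i≡1+k) =
    toℕ k , toℕ<n k ,
    subst₂ (TriangleEdge (toℕ k)) (trans (cong spineAt (sym i≡1+k)) (spineAt-toℕ i)) (apexAt-toℕ k) right-apex

  triple : Config → ℕ → Triple
  triple f j = f (spineAt j) , f (spineAt (suc j)) , f (apexAt j)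

  OffTriangle : ℕ → TVertex n → Set
  OffTriangle j w = w ≢ spineAt j × w ≢ spineAt (suc j) × w ≢ apexAt j

  right≢left : ∀ {j} → j < n → spineAt (suc j) ≢ spineAt j
  right≢left j<n eq = 1+n≢n (spineAt-injective j<n (<⇒≤ j<n) eq)

  triangle-move : ∀ {f g u v j} → j < n → TriangleEdge j u v ⊎ TriangleEdge j v u →
    2 + g u ≡ f u → g v ≡ suc (f v) → (∀ w → w ≢ u → w ≢ v → g w ≡ f w) →
    triple g j ≼ triple f j × (∀ w → OffTriangle j w → g w ≡ f w)
  triangle-move j<n (inj₁ left-right) src tgt unchanged =
    left→right src tgt (unchanged _ (λ ()) (λ ())) , λ w (≢l , ≢r , _) → unchanged w ≢l ≢r
  triangle-move j<n (inj₁ left-apex) src tgt unchanged =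
    left→apex src (unchanged _ (right≢left j<n) (λ ())) tgt , λ w (≢l , _ , ≢a) → unchanged w ≢l ≢a
  triangle-move j<n (inj₁ right-apex) src tgt unchanged =
    right→apex (unchanged _ (right≢left j<n ∘ sym) (λ ())) src tgt , λ w (_ , ≢r , ≢a) → unchanged w ≢r ≢a
  triangle-move j<n (inj₂ left-right) src tgt unchanged =
    right→left tgt src (unchanged _ (λ ()) (λ ())) , λ w (≢l , ≢r , _) → unchanged w ≢r ≢l
  triangle-move j<n (inj₂ left-apex) src tgt unchanged =
    apex→left tgt (unchanged _ (λ ()) (right≢left j<n)) src , λ w (≢l , _ , ≢a) → unchanged w ≢a ≢l
  triangle-move j<n (inj₂ right-apex) src tgt unchanged =
    apex→right (unchanged _ (λ ()) (right≢left j<n ∘ sym)) tgt src , λ w (_ , ≢r , ≢a) → unchanged w ≢a ≢r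

  triangle-step : ∀ {f g} → Step f g →
    ∃ λ j → j < n × triple g j ≼ triple f j × (∀ w → OffTriangle j w → g w ≡ f w)
  triangle-step {f} {g} (u , v , inj₁ e , _ , gu+2≡fu , gv≡1+fv , unchanged)
    with j , j<n , t ← TEdge⇒TriangleEdge e
    = j , j<n , triangle-move j<n (inj₁ t) (trans (+-comm 2 (g u)) gu+2≡fu) gv≡1+fv unchanged
  triangle-step {f} {g} (u , v , inj₂ e , _ , gu+2≡fu , gv≡1+fv , unchanged)
    with j , j<n , t ← TEdge⇒TriangleEdge e
    = j , j<n , triangle-move j<n (inj₂ t) (trans (+-comm 2 (g u)) gu+2≡fu) gv≡1+fv unchanged

  potential : Config → ℕ
  potential f = gather n (f ∘ spineAt) (f ∘ apexAt)

  potential-step : ∀ {f g} → Step f g → potential g ≤ potential f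
  potential-step s with j , j<n , local , unchanged ← triangle-step s =
    gather-local n j j<n
      (λ i i≤n i≢j i≢1+j → unchanged _ ( i≢j ∘ spineAt-injective i≤n (<⇒≤ j<n)
                                        , i≢1+j ∘ spineAt-injective i≤n j<n
                                        , λ ()))
      (λ i i<n i≢j → unchanged _ ((λ ()) , (λ ()) , i≢j ∘ apexAt-injective i<n j<n))
      local

  potential-reaches : ∀ {f g} → Reaches f g → potential g ≤ potential f
  potential-reaches ε       = ≤-refl
  potential-reaches (s ◅ r) = ≤-trans (potential-reaches r) (potential-step s)

  extremalSpine : ℕ → ℕ → ℕ
  extremalSpine s i = if i ≡ᵇ n then s else 0

  extremalApex : ℕ → ℕ → ℕ → ℕ
  extremalApex p r i = (if i <ᵇ r then 1 else 0) + (if i ≡ᵇ m then p else 0)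

  extremal : ℕ → ℕ → ℕ → Config
  extremal p s r (spine x) = extremalSpine s (toℕ x)
  extremal p s r (apex x)  = extremalApex p r (toℕ x)

  weight-extremal : ∀ p s r → r ≤ m → weight (extremal p s r) ≡ s + (r + p)
  weight-extremal p s r r≤m = begin
    weight (extremal p s r)
      ≡⟨ weight-by-index (extremal p s r) (extremalSpine s) (extremalApex p r) (λ _ → refl) (λ _ → refl) ⟩
    sumBelow (suc n) (extremalSpine s) + sumBelow n (extremalApex p r)
      ≡⟨ cong₂ _+_ (sumBelow-point (suc n) n s ≤-refl) (sumBelow-distrib n ones atLast) ⟩
    s + (sumBelow n ones + sumBelow n atLast)
      ≡⟨ cong (s +_) (cong₂ _+_ (sumBelow-prefix n r (m≤n⇒m≤1+n r≤m)) (sumBelow-point n m p ≤-refl)) ⟩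
    s + (r + p)
      ∎
    where
    open ≡-Reasoning
    ones atLast : ℕ → ℕ
    ones i = if i <ᵇ r then 1 else 0
    atLast i = if i ≡ᵇ m then p else 0

  potential-extremal : ∀ p s r → p < 2 ^ n → s ≤ 1 → r ≤ m → potential (extremal p s r) < 1
  potential-extremal p s r p<2ⁿ s≤1 r≤m = gather<2^c m 0 spine≡0 spine≤1 apex≤1 apexₘ<
    where
    spine-value : ∀ {i} → i ≤ n → extremal p s r (spineAt i) ≡ extremalSpine s i
    spine-value i≤n = cong (extremalSpine s) (toℕ-mod (s≤s i≤n))
    apex-value : ∀ {i} → i < n → extremal p s r (apexAt i) ≡ extremalApex p r i
    apex-value i<n = cong (extremalApex p r) (toℕ-mod i<n)
    spine≡0 : ∀ i → i ≤ m → extremal p s r (spineAt i) ≡ 0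
    spine≡0 i i≤m rewrite spine-value (m≤n⇒m≤1+n i≤m) | <⇒≡ᵇ-false (s≤s i≤m) = refl
    spine≤1 : extremal p s r (spineAt n) ≤ 1
    spine≤1 rewrite spine-value (≤-refl {n}) = ≤-trans (if-then-0≤ (n ≡ᵇ n) s) s≤1
    apex≤1 : ∀ i → i < m → extremal p s r (apexAt i) ≤ 1
    apex≤1 i i<m rewrite apex-value (m≤n⇒m≤1+n i<m) | <⇒≡ᵇ-false i<m =
      ≤-trans (≤-reflexive (+-identityʳ _)) (if-then-0≤ (i <ᵇ r) 1)
    apexₘ< : extremal p s r (apexAt m) < 2 ^ (0 + n)
    apexₘ< rewrite apex-value (≤-refl {n}) | ≤⇒<ᵇ-false r≤m | ≡ᵇ-refl m = p<2ⁿ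

  extremal-parameters : ∀ {k} → k < 2 ^ n + n →
                        ∃ λ p → ∃ λ s → ∃ λ r → s + (r + p) ≡ k × p < 2 ^ n × s ≤ 1 × r ≤ m
  extremal-parameters {k} k<2ⁿ+n with k <? 2 ^ n
  ... | yes k<2ⁿ = k , 0 , 0 , refl , k<2ⁿ , z≤n , z≤n
  ... | no k≮2ⁿ = pred (2 ^ n) , 1 , k ∸ 2 ^ n , sum≡k , ≤-reflexive (suc-pred (2 ^ n)) , ≤-refl , r≤m
    where
    instance
      2ⁿ≢0 : NonZero (2 ^ n)
      2ⁿ≢0 = m^n≢0 2 n
    2ⁿ≤k : 2 ^ n ≤ k
    2ⁿ≤k = ≮⇒≥ k≮2ⁿ
    sum≡k : 1 + (k ∸ 2 ^ n + pred (2 ^ n)) ≡ k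
    sum≡k = begin
      1 + (k ∸ 2 ^ n + pred (2 ^ n))   ≡⟨ +-suc (k ∸ 2 ^ n) (pred (2 ^ n)) ⟨
      k ∸ 2 ^ n + suc (pred (2 ^ n))   ≡⟨ cong (k ∸ 2 ^ n +_) (suc-pred (2 ^ n)) ⟩
      k ∸ 2 ^ n + 2 ^ n                ≡⟨ m∸n+n≡m 2ⁿ≤k ⟩
      k                                ∎
      where open ≡-Reasoning
    r≤m : k ∸ 2 ^ n ≤ m
    r≤m = s≤s⁻¹ (+-cancelˡ-< (2 ^ n) (k ∸ 2 ^ n) n (subst (_< 2 ^ n + n) (sym (m+[n∸m]≡n 2ⁿ≤k)) k<2ⁿ+n))

  lower-bound : ∀ k → PebblingProperty k → 2 ^ n + n ≤ k
  lower-bound k solvable with 2 ^ n + n ≤? k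
  ... | yes 2ⁿ+n≤k = 2ⁿ+n≤k
  ... | no 2ⁿ+n≰k
    with p , s , r , s+r+p≡k , p<2ⁿ , s≤1 , r≤m ← extremal-parameters (≰⇒> 2ⁿ+n≰k)
    with g , reach , 1≤g ← solvable (extremal p s r) (trans (weight-extremal p s r r≤m) s+r+p≡k) (spineAt 0)
    = contradiction (≤-trans 1≤g (≤-trans (m≤m+n _ _) (potential-reaches reach)))
                    (<⇒≱ (potential-extremal p s r p<2ⁿ s≤1 r≤m))

mainTheorem3 : ∀ (n : ℕ) → 1 ≤ n → Pebbling.PebblingNumber≡ (T n) (2 ^ n + n)
mainTheorem3 (suc m) _ = Cactus.upper-bound m , Cactus.lower-bound m
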